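{- Let $R$ be a countable ring with unit, $I\subseteq R$ a maximal left ideal, $V$ a left $R$-module, $X\subseteq V$ an $I$-independent subset, and $Y\subseteq X$. Then $(R*X)\cap RY=R*Y$.
   Context: $X\subseteq V$ is $I$-independent if for all distinct $x_0,\dots,x_{n-1}\in X$ and all $r_0,\dots,r_{n-1}\in R$: $\sum_{i<n}r_ix_i=0$ if and only if every $r_i\in I$. For $Y\subseteq V$, $R*Y=\{ry: r\in R, y\in Y, ry\neq 0\}$, and $RY$ is the submodule of $V$ generated by $Y$. -}

module Defs where

open import Level using (Level; _⊔_)
open import Algebra.Bundles using (Ring)
open import Algebra.Module.Bundles using (LeftModule)
open import Data.Nat using (ℕ; zero; suc)
open import Data.Fin using (Fin; zero; suc)
open import Data.Product using (Σ; ∃; _×_; _,_)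
open import Data.Sum using (_⊎_)
open import Relation.Nullary using (¬_)
open import Relation.Binary.PropositionalEquality using (_≡_; _≢_)
open import Function.Bundles using (_⇔_)
open import Relation.Unary using (Pred; _⊆_)

module _ {r ℓr : Level} (R : Ring r ℓr) where
  open Ring R

  Countable : Set (r ⊔ ℓr)
  Countable = Σ (Carrier → ℕ) λ f →
    (∀ {a b} → a ≈ b → f a ≡ f b) × (∀ {a b} → f a ≡ f b → a ≈ b)

  record IsLeftIdeal {p : Level} (I : Pred Carrier p) : Set (r ⊔ ℓr ⊔ p) where
    field
      resp      : ∀ {a b} → a ≈ b → I a → I b
      zero∈     : I 0#
      +-closed  : ∀ {a b} → I a → I b → I (a + b)
      *ₗ-closed : ∀ (s : Carrier) {a} → I a → I (s * a)

  record IsMaximalLeftIdeal {p : Level} (I : Pred Carrier p) : Set (r ⊔ ℓr Level.⊔ Level.suc p) where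
    field
      isLeftIdeal : IsLeftIdeal I
      proper      : ¬ I 1#
      maximal     : ∀ (J : Pred Carrier p) → IsLeftIdeal J → I ⊆ J →
                    (J ⊆ I) ⊎ (∀ a → J a)

module _ {r ℓr m ℓm : Level} (R : Ring r ℓr) (M : LeftModule R m ℓm) where
  open Ring R using () renaming (Carrier to R₀)
  open LeftModule M

  sumᴹ : ∀ {n} → (Fin n → Carrierᴹ) → Carrierᴹ
  sumᴹ {zero}  v = 0ᴹ
  sumᴹ {suc n} v = v zero +ᴹ sumᴹ (λ i → v (suc i))

  IIndependent : ∀ {p q} → Pred R₀ p → Pred Carrierᴹ q → Set (r ⊔ m ⊔ ℓm ⊔ p ⊔ q)
  IIndependent I X =
    ∀ (n : ℕ) (xs : Fin n → Carrierᴹ) → (∀ i → X (xs i)) →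
    (∀ i j → i ≢ j → ¬ (xs i ≈ᴹ xs j)) →
    ∀ (rs : Fin n → R₀) →
    (sumᴹ (λ i → rs i *ₗ xs i) ≈ᴹ 0ᴹ) ⇔ (∀ i → I (rs i))

  Star : ∀ {q} → Pred Carrierᴹ q → Pred Carrierᴹ (r ⊔ m ⊔ ℓm ⊔ q)
  Star Y v = Σ R₀ λ a → Σ Carrierᴹ λ y →
    Y y × (v ≈ᴹ a *ₗ y) × ¬ (v ≈ᴹ 0ᴹ)

  Span : ∀ {q} → Pred Carrierᴹ q → Pred Carrierᴹ (r ⊔ m ⊔ ℓm ⊔ q)
  Span Y v = Σ ℕ λ n → Σ (Fin n → Carrierᴹ) λ ys → Σ (Fin n → R₀) λ rs →
    (∀ i → Y (ys i)) × (v ≈ᴹ sumᴹ (λ i → rs i *ₗ ys i))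

{-# OPTIONS --safe #-}
-- Let v = a x ≠ 0 with x ∈ X, and also v = Σ rᵢ yᵢ with yᵢ ∈ Y. If x is one of the
-- yᵢ then v ∈ R*Y. Otherwise, after merging repeated yᵢ, x and the yᵢ are distinct
-- elements of X with (-a) x + Σ rᵢ yᵢ = 0, so independence forces -a ∈ I, hence a ∈ I;
-- but then independence of the one-element family {x} gives a x = 0, a contradiction.
module Submission where

open import Defs
open import Level using (Level; _⊔_)
open import Algebra.Bundles using (Ring)
open import Algebra.Module.Bundles using (LeftModule)
open import Axiom.ExcludedMiddle using (ExcludedMiddle)
open import Relation.Unary using (Pred; _⊆_; _∩_; _≐_)
open import Data.Nat using (ℕ; zero; suc)
open import Data.Fin using (Fin; zero; suc)
open import Data.Fin.Properties using (_≟_; suc-injective)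
open import Data.Vec.Functional using (_∷_)
open import Data.Product using (∃; _,_)
open import Data.Empty using (⊥-elim)
open import Relation.Nullary using (¬_; yes; no)
open import Relation.Binary.PropositionalEquality using (_≢_; refl; cong)
open import Function.Bundles using (Equivalence)
import Algebra.Properties.Ring as RingProperties

module LeftIdealProperties {r ℓr p : Level} (R : Ring r ℓr) {I : Pred (Ring.Carrier R) p}
                           (isLeftIdeal : IsLeftIdeal R I) where
  open Ring R
  open RingProperties R using (-1*x≈-x; -‿involutive)
  open IsLeftIdeal isLeftIdeal

  -‿closed⁻¹ : ∀ {a} → I (- a) → I a
  -‿closed⁻¹ {a} -a∈I = resp (trans (-1*x≈-x (- a)) (-‿involutive a)) (*ₗ-closed (- 1#) -a∈I)

module Combinations {r ℓr m ℓm : Level} (R : Ring r ℓr) (M : LeftModule R m ℓm) where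
  open Ring R using (_+_) renaming (Carrier to R₀)
  open LeftModule M
  open import Relation.Binary.Reasoning.Setoid ≈ᴹ-setoid

  Distinct : ∀ {n} → (Fin n → Carrierᴹ) → Set ℓm
  Distinct xs = ∀ i j → i ≢ j → ¬ (xs i ≈ᴹ xs j)

  distinct-∷ : ∀ {n} {x} {xs : Fin n → Carrierᴹ} →
    (∀ j → ¬ (x ≈ᴹ xs j)) → Distinct xs → Distinct (x ∷ xs)
  distinct-∷ x∉xs xs-distinct zero    zero    0≢0 _ = 0≢0 refl
  distinct-∷ x∉xs xs-distinct zero    (suc j) _   e = x∉xs j e
  distinct-∷ x∉xs xs-distinct (suc i) zero    _   e = x∉xs i (≈ᴹ-sym e)
  distinct-∷ x∉xs xs-distinct (suc i) (suc j) i≢j e = xs-distinct i j (λ i≡j → i≢j (cong suc i≡j)) e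

  distinct-resp : ∀ {n} {xs ys : Fin n → Carrierᴹ} → (∀ i → xs i ≈ᴹ ys i) → Distinct xs → Distinct ys
  distinct-resp xs≈ys xs-distinct i j i≢j e =
    xs-distinct i j i≢j (≈ᴹ-trans (xs≈ys i) (≈ᴹ-trans e (≈ᴹ-sym (xs≈ys j))))

  distinct-singleton : ∀ x → Distinct {1} (λ _ → x)
  distinct-singleton x zero zero 0≢0 _ = 0≢0 refl

  sumᴹ-cong : ∀ {n} {f g : Fin n → Carrierᴹ} → (∀ i → f i ≈ᴹ g i) → sumᴹ R M f ≈ᴹ sumᴹ R M g
  sumᴹ-cong {zero}  f≈g = ≈ᴹ-refl
  sumᴹ-cong {suc n} f≈g = +ᴹ-cong (f≈g zero) (sumᴹ-cong (λ i → f≈g (suc i)))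

  +ᴹ-swapˡ : ∀ x y z → x +ᴹ (y +ᴹ z) ≈ᴹ y +ᴹ (x +ᴹ z)
  +ᴹ-swapˡ x y z = begin
    x +ᴹ (y +ᴹ z) ≈⟨ ≈ᴹ-sym (+ᴹ-assoc x y z) ⟩
    (x +ᴹ y) +ᴹ z ≈⟨ +ᴹ-congʳ (+ᴹ-comm x y) ⟩
    (y +ᴹ x) +ᴹ z ≈⟨ +ᴹ-assoc y x z ⟩
    y +ᴹ (x +ᴹ z) ∎

  sumᴹ-addAt : ∀ {n} (j : Fin n) (c : Carrierᴹ) {f g : Fin n → Carrierᴹ} →
    g j ≈ᴹ c +ᴹ f j → (∀ i → i ≢ j → g i ≈ᴹ f i) → sumᴹ R M g ≈ᴹ c +ᴹ sumᴹ R M f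
  sumᴹ-addAt zero c gj≈ g≈f = begin
    _ ≈⟨ +ᴹ-cong gj≈ (sumᴹ-cong (λ i → g≈f (suc i) λ ())) ⟩
    _ ≈⟨ +ᴹ-assoc _ _ _ ⟩
    _ ∎
  sumᴹ-addAt (suc j) c gj≈ g≈f = begin
    _ ≈⟨ +ᴹ-cong (g≈f zero λ ()) (sumᴹ-addAt j c gj≈ (λ i i≢j → g≈f (suc i) (λ e → i≢j (suc-injective e)))) ⟩
    _ ≈⟨ +ᴹ-swapˡ _ _ _ ⟩
    _ ∎

  record DistinctCombination {n} (ys : Fin n → Carrierᴹ) (v : Carrierᴹ) : Set (r ⊔ ℓm) where
    field
      k        : ℕ
      index    : Fin k → Fin n
      coeff    : Fin k → R₀
      distinct : Distinct (λ j → ys (index j))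
      sum≈     : v ≈ᴹ sumᴹ R M (λ j → coeff j *ₗ ys (index j))

  module _ {n} {ys : Fin (suc n) → Carrierᴹ} {v} (r₀ : R₀)
           (c : DistinctCombination (λ i → ys (suc i)) v) where
    open DistinctCombination c

    combination-merge : ∀ j → ys zero ≈ᴹ ys (suc (index j)) →
      DistinctCombination ys (r₀ *ₗ ys zero +ᴹ v)
    combination-merge j y₀≈ = record
      { k = k ; index = λ i → suc (index i) ; coeff = coeff′
      ; distinct = distinct ; sum≈ = sum≈′ }
      where
      coeff′ : Fin k → R₀
      coeff′ i with i ≟ j
      ... | yes _ = r₀ + coeff i
      ... | no  _ = coeff i
      at-j : coeff′ j *ₗ ys (suc (index j)) ≈ᴹ r₀ *ₗ ys (suc (index j)) +ᴹ coeff j *ₗ ys (suc (index j))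
      at-j with j ≟ j
      ... | yes _   = *ₗ-distribʳ _ _ _
      ... | no  j≢j = ⊥-elim (j≢j refl)
      off-j : ∀ i → i ≢ j → coeff′ i *ₗ ys (suc (index i)) ≈ᴹ coeff i *ₗ ys (suc (index i))
      off-j i i≢j with i ≟ j
      ... | yes i≡j = ⊥-elim (i≢j i≡j)
      ... | no  _   = ≈ᴹ-refl
      sum≈′ : r₀ *ₗ ys zero +ᴹ v ≈ᴹ sumᴹ R M (λ i → coeff′ i *ₗ ys (suc (index i)))
      sum≈′ = begin
        r₀ *ₗ ys zero +ᴹ v
          ≈⟨ +ᴹ-cong (*ₗ-congˡ y₀≈) sum≈ ⟩
        r₀ *ₗ ys (suc (index j)) +ᴹ sumᴹ R M (λ i → coeff i *ₗ ys (suc (index i)))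
          ≈⟨ ≈ᴹ-sym (sumᴹ-addAt j _ at-j off-j) ⟩
        sumᴹ R M (λ i → coeff′ i *ₗ ys (suc (index i))) ∎

    combination-prepend : (∀ j → ¬ (ys zero ≈ᴹ ys (suc (index j)))) →
      DistinctCombination ys (r₀ *ₗ ys zero +ᴹ v)
    combination-prepend y₀∉ = record
      { k = suc k ; index = zero ∷ (λ i → suc (index i)) ; coeff = r₀ ∷ coeff
      ; distinct = distinct-resp (λ { zero → ≈ᴹ-refl ; (suc i) → ≈ᴹ-refl }) (distinct-∷ y₀∉ distinct)
      ; sum≈ = +ᴹ-congˡ sum≈ }

    combination-cons : ExcludedMiddle ℓm → DistinctCombination ys (r₀ *ₗ ys zero +ᴹ v)
    combination-cons lem with lem {∃ λ j → ys zero ≈ᴹ ys (suc (index j))}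
    ... | yes (j , y₀≈) = combination-merge j y₀≈
    ... | no  y₀∉       = combination-prepend (λ j e → y₀∉ (j , e))

  distinctCombination : ExcludedMiddle ℓm → ∀ {n} (ys : Fin n → Carrierᴹ) (rs : Fin n → R₀) →
    DistinctCombination ys (sumᴹ R M (λ i → rs i *ₗ ys i))
  distinctCombination lem {zero} ys rs = record
    { k = zero ; index = λ () ; coeff = λ () ; distinct = λ () ; sum≈ = ≈ᴹ-refl }
  distinctCombination lem {suc n} ys rs =
    combination-cons (rs zero) (distinctCombination lem (λ i → ys (suc i)) (λ i → rs (suc i))) lem

module _ {r ℓr m ℓm qx qy : Level} (R : Ring r ℓr) (M : LeftModule R m ℓm)
         {X : Pred (LeftModule.Carrierᴹ M) qx}
         {Y : Pred (LeftModule.Carrierᴹ M) qy} where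
  open Ring R using (-_; 0#; _+_; -‿inverseˡ)
  open LeftModule M
  open Combinations R M
  open import Relation.Binary.Reasoning.Setoid ≈ᴹ-setoid

  independent-annihilated : ∀ {p} {I : Pred (Ring.Carrier R) p} → IIndependent R M I X →
    ∀ {a x} → X x → I a → a *ₗ x ≈ᴹ 0ᴹ
  independent-annihilated indep {a} {x} x∈X a∈I = begin
    a *ₗ x        ≈⟨ ≈ᴹ-sym (+ᴹ-identityʳ _) ⟩
    a *ₗ x +ᴹ 0ᴹ  ≈⟨ Equivalence.from (indep 1 _ (λ _ → x∈X) (distinct-singleton x) (λ _ → a)) (λ { zero → a∈I }) ⟩
    0ᴹ            ∎

  star∩span⊆star : ∀ {p} {I : Pred (Ring.Carrier R) p} → ExcludedMiddle ℓm → IsLeftIdeal R I →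
    IIndependent R M I X → Y ⊆ X → (Star R M X ∩ Span R M Y) ⊆ Star R M Y
  star∩span⊆star {I = I} lem isLeftIdeal indep Y⊆X
    ((a , x , x∈X , v≈ax , v≉0) , (n , ys , rs , ys∈Y , v≈Σ))
    with lem {∃ λ i → x ≈ᴹ ys i}
  ... | yes (i , x≈yᵢ) = a , ys i , ys∈Y i , ≈ᴹ-trans v≈ax (*ₗ-congˡ x≈yᵢ) , v≉0
  ... | no  x∉ys       = ⊥-elim (v≉0 (≈ᴹ-trans v≈ax (independent-annihilated indep x∈X a∈I)))
    where
    open DistinctCombination (distinctCombination lem ys rs)
    open LeftIdealProperties R isLeftIdeal
    zs = x ∷ (λ j → ys (index j))
    relation : sumᴹ R M (λ i → ((- a) ∷ coeff) i *ₗ zs i) ≈ᴹ 0ᴹ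
    relation = begin
      (- a) *ₗ x +ᴹ sumᴹ R M (λ j → coeff j *ₗ ys (index j))
        ≈⟨ +ᴹ-congˡ (≈ᴹ-trans (≈ᴹ-sym sum≈) (≈ᴹ-trans (≈ᴹ-sym v≈Σ) v≈ax)) ⟩
      (- a) *ₗ x +ᴹ a *ₗ x ≈⟨ ≈ᴹ-sym (*ₗ-distribʳ x (- a) a) ⟩
      (- a + a) *ₗ x       ≈⟨ *ₗ-congʳ (-‿inverseˡ a) ⟩
      0# *ₗ x              ≈⟨ *ₗ-zeroˡ x ⟩
      0ᴹ                   ∎
    zs∈X : ∀ i → X (zs i)
    zs∈X zero    = x∈X
    zs∈X (suc j) = Y⊆X (ys∈Y (index j))
    a∈I : I a
    a∈I = -‿closed⁻¹ (Equivalence.to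
      (indep _ zs zs∈X (distinct-∷ (λ j e → x∉ys (index j , e)) distinct) ((- a) ∷ coeff)) relation zero)

  star⊆star∩span : Y ⊆ X → Star R M Y ⊆ (Star R M X ∩ Span R M Y)
  star⊆star∩span Y⊆X (a , y , y∈Y , v≈ay , v≉0) =
    (a , y , Y⊆X y∈Y , v≈ay , v≉0) ,
    (1 , (λ _ → y) , (λ _ → a) , (λ _ → y∈Y) , ≈ᴹ-trans v≈ay (≈ᴹ-sym (+ᴹ-identityʳ _)))

lemma2p7 : ∀ {r ℓr m ℓm p qx qy : Level} →
    (∀ {a : Level} → ExcludedMiddle a) →
    (R : Ring r ℓr) → Countable R →
    (I : Pred (Ring.Carrier R) p) → IsMaximalLeftIdeal R I →
    (M : LeftModule R m ℓm) →
    (X : Pred (LeftModule.Carrierᴹ M) qx) → (Y : Pred (LeftModule.Carrierᴹ M) qy) →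
    IIndependent R M I X → Y ⊆ X →
    (Star R M X ∩ Span R M Y) ≐ Star R M Y
lemma2p7 lem R _ I maxI M X Y indep Y⊆X =
  star∩span⊆star R M lem (IsMaximalLeftIdeal.isLeftIdeal maxI) indep Y⊆X ,
  star⊆star∩span R M Y⊆X
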